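{- Let $n=p_1^{\alpha_1}p_2^{\alpha_2}\cdots p_k^{\alpha_k}$ with $k\ge3$, distinct primes $p_i$ and positive integers $\alpha_i$. Then the coefficient of the term of smallest degree in the domination polynomial of $\Gamma(\mathbb{Z}_n)$ (i.e. the number of dominating sets of minimum size) equals $(p_1-1)(p_2-1)\cdots(p_k-1)$.
   Context: For a commutative ring $R$ with identity, the zero-divisor graph $\Gamma(R)$ is the simple undirected graph whose vertices are the nonzero zero-divisors of $R$, two distinct vertices $u,v$ being adjacent iff $uv=0$. A dominating set of a graph $G$ is a set $D$ of vertices such that every vertex not in $D$ is adjacent to a vertex of $D$. The domination polynomial of $G$ is $\sum_{i} d(G,i)x^i$, where $d(G,i)$ is the number of dominating sets of $G$ of size $i$; its term of smallest degree has degree equal to the domination number of $G$. -}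

module Defs where

open import Data.Nat using (ℕ; zero; suc; _*_; _≤_; _≤?_; _≟_)
open import Data.Nat.Divisibility using (_∣_; _∣?_)
open import Data.Fin using (Fin; toℕ) renaming (zero to fzero; suc to fsuc; _≟_ to _≟F_)
open import Data.Fin.Properties using (all?; any?)
open import Data.Fin.Subset using (Subset; _∈_; _∉_; ∣_∣)
open import Data.Fin.Subset.Properties using (_∈?_)
open import Data.Vec using ([]; _∷_)
open import Data.Bool using (true; false)
open import Data.List using (List; [_]; map; _++_; filter; length)
open import Data.Product using (Σ; ∃; _×_; _,_; proj₁; proj₂)
open import Relation.Binary.PropositionalEquality using (_≡_; _≢_)
open import Relation.Nullary using (Dec; yes; no; ¬?)
open import Relation.Nullary.Decidable using (_×-dec_; _→-dec_)

prodFin : (k : ℕ) → (Fin k → ℕ) → ℕ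
prodFin zero    f = 1
prodFin (suc k) f = f fzero * prodFin k (λ i → f (fsuc i))

-- The ring ℤ_n is represented by Fin n (the residue class of toℕ x).
-- x·y = 0 in ℤ_n  iff  n ∣ toℕ x * toℕ y.

IsVertex : (n : ℕ) → Fin n → Set
IsVertex n x = (toℕ x ≢ 0) × ∃ λ (y : Fin n) → (toℕ y ≢ 0) × (n ∣ toℕ x * toℕ y)

Adj : (n : ℕ) → Fin n → Fin n → Set
Adj n x y = (x ≢ y) × (n ∣ toℕ x * toℕ y)

IsDominating : (n : ℕ) → Subset n → Set
IsDominating n D =
  (∀ x → x ∈ D → IsVertex n x) ×
  (∀ v → IsVertex n v → v ∉ D → ∃ λ u → u ∈ D × Adj n u v)

IsMinDominating : (n : ℕ) → Subset n → Set
IsMinDominating n D =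
  IsDominating n D × (∀ E → IsDominating n E → ∣ D ∣ ≤ ∣ E ∣)

allSub? : ∀ {n} {P : Subset n → Set} → (∀ E → Dec (P E)) → Dec (∀ E → P E)
allSub? {zero} {P} P? with P? []
... | yes p = yes λ { [] → p }
... | no ¬p = no λ h → ¬p (h [])
allSub? {suc n} {P} P? with allSub? (λ E → P? (false ∷ E)) | allSub? (λ E → P? (true ∷ E))
... | yes f | yes t = yes λ { (false ∷ E) → f E ; (true ∷ E) → t E }
... | no ¬f | _     = no λ h → ¬f (λ E → h (false ∷ E))
... | yes _ | no ¬t = no λ h → ¬t (λ E → h (true ∷ E))

IsVertex? : ∀ n x → Dec (IsVertex n x)
IsVertex? n x = ¬? (toℕ x ≟ 0) ×-dec any? (λ y → ¬? (toℕ y ≟ 0) ×-dec (n ∣? toℕ x * toℕ y))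

Adj? : ∀ n x y → Dec (Adj n x y)
Adj? n x y = ¬? (x ≟F y) ×-dec (n ∣? toℕ x * toℕ y)

IsDominating? : ∀ n D → Dec (IsDominating n D)
IsDominating? n D =
  all? (λ x → (x ∈? D) →-dec IsVertex? n x) ×-dec
  all? (λ v → IsVertex? n v →-dec (¬? (v ∈? D) →-dec
               any? (λ u → (u ∈? D) ×-dec Adj? n u v)))

IsMinDominating? : ∀ n D → Dec (IsMinDominating n D)
IsMinDominating? n D =
  IsDominating? n D ×-dec allSub? (λ E → IsDominating? n E →-dec (∣ D ∣ ≤? ∣ E ∣))

-- Enumeration of all subsets of Fin n (each exactly once), and the
-- number of minimum dominating sets of Γ(ℤ_n), i.e. the coefficient of
-- the lowest-degree term of the domination polynomial of Γ(ℤ_n).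

allSubsets : ∀ n → List (Subset n)
allSubsets zero    = [ [] ]
allSubsets (suc n) = map (false ∷_) (allSubsets n) ++ map (true ∷_) (allSubsets n)

minDomCount : ℕ → ℕ
minDomCount n = length (filter (IsMinDominating? n) (allSubsets n))

-- Write q i = n / p i. The neighbourhood of the vertex p i of Γ(ℤ_n) is the set C i of the
-- p i − 1 nonzero multiples of q i, and these sets are pairwise disjoint. Adding ±p i to C i gives
-- disjoint sets T i, each of which a dominating set must meet in order to dominate p i, so the
-- domination number is at least k. Conversely, a set with exactly one element in each C i (and no
-- others) dominates, since every zero-divisor is divisible by some p i; so the domination number
-- is k. A dominating set of size k has exactly one element in each T i, and that element cannot
-- be ±p i: its twin ∓p i has the same neighbourhood C i and would be left undominated. (Here
-- k ≥ 3 guarantees 2 p i ≠ n and that no q j divides a p i, which keeps the T i disjoint.) Hence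
-- the minimum dominating sets are exactly the transversals of the classes C i, and there are
-- ∏ (p i − 1) of them.

module Submission where

open import Defs
open import Data.Nat
  using (ℕ; zero; suc; _+_; _*_; _^_; _∸_; _≤_; _<_; z≤n; s≤s; _≟_; NonZero; ≢-nonZero; ≢-nonZero⁻¹; nonTrivial⇒n>1)
open import Data.Nat.Properties
open import Data.Nat.Divisibility
open import Data.Nat.Primality
  using (Prime; prime⇒irreducible; ¬prime[1]; euclidsLemma; prime[2]; prime⇒nonZero; prime⇒nonTrivial)
open import Data.Nat.Coprimality using (Coprime; coprime-divisor; 1-coprimeTo)
open import Data.Fin using (Fin; toℕ; fromℕ<) renaming (zero to fzero; suc to fsuc)
open import Data.Fin.Properties
  using (any?; all?; punchInᵢ≢i; toℕ<n; toℕ-fromℕ<) renaming (_≟_ to _≟F_; suc-injective to fsuc-injective)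
open import Data.Fin.Subset using (Subset; _∈_; _∉_; ∣_∣)
open import Data.Fin.Subset.Properties using (_∈?_)
open import Data.Vec using ([]; _∷_; here; there)
open import Data.Vec.Functional using (updateAt; tail)
open import Data.Vec.Functional.Properties using (updateAt-updates; updateAt-minimal)
open import Data.Bool using (Bool; true; false; if_then_else_)
open import Data.Bool.Properties using (¬-not) renaming (_≟_ to _≟B_)
open import Data.Maybe using (Maybe; just; nothing)
open import Data.Maybe.Properties using (just-injective) renaming (≡-dec to ≡-decMaybe)
open import Data.List using (List; []; _∷_; map; _++_; filter; length)
open import Data.List.Properties using (length-++; filter-++; filter-none; filter-accept; filter-reject; filter-≐)
open import Data.List.Relation.Unary.All using (universal)
open import Data.Product using (∃; _×_; _,_; proj₁; proj₂)
open import Data.Sum using (_⊎_; inj₁; inj₂)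
open import Function using (_∘_)
open import Level using (0ℓ)
open import Relation.Binary.PropositionalEquality
open import Relation.Nullary using (Dec; does; yes; no; ¬_; ¬?; contradiction)
open import Relation.Nullary.Decidable using (_×-dec_; _⊎-dec_)
open import Relation.Unary using (Pred; Decidable; _⊆_; _≐_)
open import Algebra.Properties.CommutativeMonoid.Sum +-0-commutativeMonoid
  using (sum-syntax; sum-cong-≗; sum-replicate-zero; ∑-distrib-+; sum-remove)
open import Algebra.Properties.CommutativeSemigroup +-commutativeSemigroup
  using () renaming (interchange to +-interchange)

private variable
  P Q : Set

indicator : Dec P → ℕ
indicator (yes _) = 1
indicator (no _)  = 0

indicator-yes : (P? : Dec P) → P → indicator P? ≡ 1
indicator-yes (yes _) _  = refl
indicator-yes (no ¬p) p = contradiction p ¬p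

indicator-no : (P? : Dec P) → ¬ P → indicator P? ≡ 0
indicator-no (yes p) ¬p = contradiction p ¬p
indicator-no (no _)  _  = refl

indicator>0⇒ : (P? : Dec P) → 0 < indicator P? → P
indicator>0⇒ (yes p) _ = p

indicator-mono : (P? : Dec P) (Q? : Dec Q) → (P → Q) → indicator P? ≤ indicator Q?
indicator-mono (no _)  _       _   = z≤n
indicator-mono (yes _) (yes _) _   = ≤-refl
indicator-mono (yes p) (no ¬q) P⇒Q = contradiction (P⇒Q p) ¬q

indicator-cong : (P? : Dec P) (Q? : Dec Q) → (P → Q) → (Q → P) → indicator P? ≡ indicator Q?
indicator-cong P? Q? P⇒Q Q⇒P = ≤-antisym (indicator-mono P? Q? P⇒Q) (indicator-mono Q? P? Q⇒P)

∑-const-1 : ∀ k → ∑[ i < k ] 1 ≡ k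
∑-const-1 zero    = refl
∑-const-1 (suc k) = cong suc (∑-const-1 k)

∑≥k : ∀ k (f : Fin k → ℕ) → (∀ i → 0 < f i) → k ≤ ∑[ i < k ] f i
∑≥k zero    f f>0 = z≤n
∑≥k (suc k) f f>0 = +-mono-≤ (f>0 fzero) (∑≥k k (f ∘ fsuc) (f>0 ∘ fsuc))

∑≤k⇒≡1 : ∀ k (f : Fin k → ℕ) → (∀ i → 0 < f i) → ∑[ i < k ] f i ≤ k → ∀ i → f i ≡ 1
∑≤k⇒≡1 (suc k) f f>0 ∑≤ fzero = ≤-antisym f₀≤1 (f>0 fzero)
  where
  f₀≤1 : f fzero ≤ 1
  f₀≤1 = +-cancelʳ-≤ k (f fzero) 1 (≤-trans (+-monoʳ-≤ (f fzero) (∑≥k k (f ∘ fsuc) (f>0 ∘ fsuc))) ∑≤)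
∑≤k⇒≡1 (suc k) f f>0 ∑≤ (fsuc i) =
  ∑≤k⇒≡1 k (f ∘ fsuc) (f>0 ∘ fsuc) (+-cancelˡ-≤ 1 _ _ (≤-trans (+-monoˡ-≤ _ (f>0 fzero)) ∑≤)) i

∑-toℕ-+ : ∀ m n (g : ℕ → ℕ) →
  ∑[ x < m + n ] g (toℕ x) ≡ ∑[ x < m ] g (toℕ x) + ∑[ y < n ] g (m + toℕ y)
∑-toℕ-+ zero    n g = refl
∑-toℕ-+ (suc m) n g = trans (cong (g 0 +_) (∑-toℕ-+ m n (g ∘ suc))) (sym (+-assoc (g 0) _ _))

∑-multiples-period : ∀ q .{{_ : NonZero q}} → ∑[ x < q ] indicator (q ∣? toℕ x) ≡ 1
∑-multiples-period (suc q) = cong₂ _+_ (indicator-yes (suc q ∣? 0) (suc q ∣0))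
  (trans (sum-cong-≗ {q} (λ x → indicator-no (suc q ∣? suc (toℕ x)) (q∤ x))) (sum-replicate-zero q))
  where
  q∤ : ∀ (x : Fin q) → ¬ (suc q ∣ suc (toℕ x))
  q∤ x q∣x = <⇒≱ (s≤s (toℕ<n x)) (∣⇒≤ q∣x)

∑-multiples : ∀ m q .{{_ : NonZero q}} → ∑[ x < m * q ] indicator (q ∣? toℕ x) ≡ m
∑-multiples zero    q = refl
∑-multiples (suc m) q = begin
  ∑[ x < q + m * q ] indicator (q ∣? toℕ x)
    ≡⟨ ∑-toℕ-+ q (m * q) (λ y → indicator (q ∣? y)) ⟩
  ∑[ x < q ] indicator (q ∣? toℕ x) + ∑[ y < m * q ] indicator (q ∣? (q + toℕ y))
    ≡⟨ cong₂ _+_ (∑-multiples-period q) (sum-cong-≗ {m * q} (λ y → shift (toℕ y))) ⟩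
  1 + ∑[ y < m * q ] indicator (q ∣? toℕ y)
    ≡⟨ cong suc (∑-multiples m q) ⟩
  suc m ∎
  where
  open ≡-Reasoning
  shift : ∀ y → indicator (q ∣? (q + y)) ≡ indicator (q ∣? y)
  shift y = indicator-cong (q ∣? (q + y)) (q ∣? y)
    (λ q∣q+y → ∣m+n∣m⇒∣n q∣q+y ∣-refl) (∣m∣n⇒∣m+n ∣-refl)

∑-nonzeroMultiples : ∀ m q .{{_ : NonZero q}} →
  ∑[ x < m * q ] indicator (¬? (toℕ x ≟ 0) ×-dec (q ∣? toℕ x)) ≡ m ∸ 1
∑-nonzeroMultiples zero    q       = refl
∑-nonzeroMultiples (suc m) (suc q) = suc-injective (begin
  suc (∑[ x < suc (q + m * suc q) ] indicator (¬? (toℕ x ≟ 0) ×-dec (suc q ∣? toℕ x)))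
    ≡⟨ cong₂ (λ a b → suc (a + b)) (indicator-no (¬? (0 ≟ 0) ×-dec (suc q ∣? 0)) (λ (0≢0 , _) → 0≢0 refl))
                                  (sum-cong-≗ {q + m * suc q} (λ x → nonzero (toℕ x))) ⟩
  suc (∑[ x < q + m * suc q ] indicator (suc q ∣? suc (toℕ x)))
    ≡⟨ cong (_+ ∑[ x < q + m * suc q ] indicator (suc q ∣? suc (toℕ x)))
            (indicator-yes (suc q ∣? 0) (suc q ∣0)) ⟨
  ∑[ x < suc m * suc q ] indicator (suc q ∣? toℕ x)
    ≡⟨ ∑-multiples (suc m) (suc q) ⟩
  suc m ∎)
  where
  open ≡-Reasoning
  nonzero : ∀ y → indicator (¬? (suc y ≟ 0) ×-dec (suc q ∣? suc y)) ≡ indicator (suc q ∣? suc y)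
  nonzero y = indicator-cong (¬? (suc y ≟ 0) ×-dec (suc q ∣? suc y)) (suc q ∣? suc y) proj₂ ((λ ()) ,_)

prodFin-cong : ∀ k {f g : Fin k → ℕ} → (∀ i → f i ≡ g i) → prodFin k f ≡ prodFin k g
prodFin-cong zero    f≡g = refl
prodFin-cong (suc k) f≡g = cong₂ _*_ (f≡g fzero) (prodFin-cong k (f≡g ∘ fsuc))

prodFin-zero : ∀ k {f : Fin k → ℕ} (j : Fin k) → f j ≡ 0 → prodFin k f ≡ 0
prodFin-zero (suc k) {f} fzero    fj≡0 = cong (_* prodFin k (f ∘ fsuc)) fj≡0
prodFin-zero (suc k) {f} (fsuc j) fj≡0 =
  trans (cong (f fzero *_) (prodFin-zero k j fj≡0)) (*-zeroʳ (f fzero))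

prodFin-one : ∀ k {f : Fin k → ℕ} → (∀ i → f i ≡ 1) → prodFin k f ≡ 1
prodFin-one zero    f≡1 = refl
prodFin-one (suc k) f≡1 = cong₂ _*_ (f≡1 fzero) (prodFin-one k (f≡1 ∘ fsuc))

prodFin>0 : ∀ k (f : Fin k → ℕ) → (∀ i → 0 < f i) → 0 < prodFin k f
prodFin>0 zero    f f>0 = s≤s z≤n
prodFin>0 (suc k) f f>0 = *-mono-≤ (f>0 fzero) (prodFin>0 k (f ∘ fsuc) (f>0 ∘ fsuc))

∣prodFin : ∀ k (f : Fin k → ℕ) i → f i ∣ prodFin k f
∣prodFin (suc k) f fzero    = m∣m*n _
∣prodFin (suc k) f (fsuc i) = ∣n⇒∣m*n (f fzero) (∣prodFin k (f ∘ fsuc) i)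

prodFin-+-at : ∀ k {f g h : Fin k → ℕ} (j : Fin k) → f j ≡ g j + h j →
  (∀ i → i ≢ j → f i ≡ g i) → (∀ i → i ≢ j → g i ≡ h i) →
  prodFin k f ≡ prodFin k g + prodFin k h
prodFin-+-at (suc k) {f} {g} {h} fzero fj f≡g g≡h = begin
  f fzero * prodFin k (f ∘ fsuc)                 ≡⟨ cong₂ _*_ fj (prodFin-cong k (λ i → f≡g (fsuc i) λ ())) ⟩
  (g fzero + h fzero) * prodFin k (g ∘ fsuc)     ≡⟨ *-distribʳ-+ _ (g fzero) (h fzero) ⟩
  g fzero * prodFin k (g ∘ fsuc) + h fzero * prodFin k (g ∘ fsuc)
    ≡⟨ cong (λ z → g fzero * prodFin k (g ∘ fsuc) + h fzero * z) (prodFin-cong k (λ i → g≡h (fsuc i) λ ())) ⟩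
  g fzero * prodFin k (g ∘ fsuc) + h fzero * prodFin k (h ∘ fsuc) ∎
  where open ≡-Reasoning
prodFin-+-at (suc k) {f} {g} {h} (fsuc j) fj f≡g g≡h = begin
  f fzero * prodFin k (f ∘ fsuc)
    ≡⟨ cong₂ _*_ (f≡g fzero λ ()) (prodFin-+-at k j fj (λ i i≢j → f≡g (fsuc i) (i≢j ∘ fsuc-injective))
                                                       (λ i i≢j → g≡h (fsuc i) (i≢j ∘ fsuc-injective))) ⟩
  g fzero * (prodFin k (g ∘ fsuc) + prodFin k (h ∘ fsuc))
    ≡⟨ *-distribˡ-+ (g fzero) _ _ ⟩
  g fzero * prodFin k (g ∘ fsuc) + g fzero * prodFin k (h ∘ fsuc)
    ≡⟨ cong (λ z → g fzero * prodFin k (g ∘ fsuc) + z * prodFin k (h ∘ fsuc)) (g≡h fzero λ ()) ⟩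
  g fzero * prodFin k (g ∘ fsuc) + h fzero * prodFin k (h ∘ fsuc) ∎
  where open ≡-Reasoning

sumOver : ∀ {n} → Subset n → (Fin n → ℕ) → ℕ
sumOver []          f = 0
sumOver (false ∷ D) f = sumOver D (f ∘ fsuc)
sumOver (true ∷ D)  f = f fzero + sumOver D (f ∘ fsuc)

sumOver-cong : ∀ {n} (D : Subset n) {f g : Fin n → ℕ} → (∀ x → f x ≡ g x) → sumOver D f ≡ sumOver D g
sumOver-cong []          f≡g = refl
sumOver-cong (false ∷ D) f≡g = sumOver-cong D (f≡g ∘ fsuc)
sumOver-cong (true ∷ D)  f≡g = cong₂ _+_ (f≡g fzero) (sumOver-cong D (f≡g ∘ fsuc))

sumOver-const-1 : ∀ {n} (D : Subset n) → sumOver D (λ _ → 1) ≡ ∣ D ∣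
sumOver-const-1 []          = refl
sumOver-const-1 (false ∷ D) = sumOver-const-1 D
sumOver-const-1 (true ∷ D)  = cong suc (sumOver-const-1 D)

sumOver-+ : ∀ {n} (D : Subset n) (f g : Fin n → ℕ) →
  sumOver D (λ x → f x + g x) ≡ sumOver D f + sumOver D g
sumOver-+ []          f g = refl
sumOver-+ (false ∷ D) f g = sumOver-+ D (f ∘ fsuc) (g ∘ fsuc)
sumOver-+ (true ∷ D)  f g =
  trans (cong (f fzero + g fzero +_) (sumOver-+ D (f ∘ fsuc) (g ∘ fsuc)))
        (+-interchange (f fzero) (g fzero) (sumOver D (f ∘ fsuc)) (sumOver D (g ∘ fsuc)))

sumOver-∑ : ∀ {n k} (D : Subset n) (f : Fin n → Fin k → ℕ) →
  sumOver D (λ x → ∑[ i < k ] f x i) ≡ ∑[ i < k ] sumOver D (λ x → f x i)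
sumOver-∑ {k = k} []    f = sym (sum-replicate-zero k)
sumOver-∑ (false ∷ D)   f = sumOver-∑ D (f ∘ fsuc)
sumOver-∑ (true ∷ D)    f =
  trans (cong (∑[ i < _ ] f fzero i +_) (sumOver-∑ D (f ∘ fsuc))) (sym (∑-distrib-+ (f fzero) _))

sumOver-mono : ∀ {n} (D : Subset n) {f g : Fin n → ℕ} → (∀ x → x ∈ D → f x ≤ g x) →
  sumOver D f ≤ sumOver D g
sumOver-mono []          f≤g = z≤n
sumOver-mono (false ∷ D) f≤g = sumOver-mono D (λ x x∈D → f≤g (fsuc x) (there x∈D))
sumOver-mono (true ∷ D)  f≤g =
  +-mono-≤ (f≤g fzero here) (sumOver-mono D (λ x x∈D → f≤g (fsuc x) (there x∈D)))

sumOver≡0 : ∀ {n} (D : Subset n) {f : Fin n → ℕ} → (∀ x → x ∈ D → f x ≡ 0) → sumOver D f ≡ 0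
sumOver≡0 []          f≡0 = refl
sumOver≡0 (false ∷ D) f≡0 = sumOver≡0 D (λ x x∈D → f≡0 (fsuc x) (there x∈D))
sumOver≡0 (true ∷ D)  f≡0 = cong₂ _+_ (f≡0 fzero here) (sumOver≡0 D (λ x x∈D → f≡0 (fsuc x) (there x∈D)))

∈⇒≤sumOver : ∀ {n} (D : Subset n) (f : Fin n → ℕ) {x} → x ∈ D → f x ≤ sumOver D f
∈⇒≤sumOver (true ∷ D)  f here        = m≤m+n _ _
∈⇒≤sumOver (false ∷ D) f (there x∈D) = ∈⇒≤sumOver D (f ∘ fsuc) x∈D
∈⇒≤sumOver (true ∷ D)  f (there x∈D) = ≤-trans (∈⇒≤sumOver D (f ∘ fsuc) x∈D) (m≤n+m _ _)

sumOver≡0⇒ : ∀ {n} (D : Subset n) (f : Fin n → ℕ) {x} → sumOver D f ≡ 0 → x ∈ D → f x ≡ 0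
sumOver≡0⇒ D f ∑≡0 x∈D = n≤0⇒n≡0 (subst (_ ≤_) ∑≡0 (∈⇒≤sumOver D f x∈D))

∈₂⇒≤sumOver : ∀ {n} (D : Subset n) (f : Fin n → ℕ) {x y} → x ∈ D → y ∈ D → x ≢ y →
  f x + f y ≤ sumOver D f
∈₂⇒≤sumOver (true ∷ D) f here here x≢y = contradiction refl x≢y
∈₂⇒≤sumOver (true ∷ D) f here (there y∈D) _ = +-monoʳ-≤ (f fzero) (∈⇒≤sumOver D (f ∘ fsuc) y∈D)
∈₂⇒≤sumOver (true ∷ D) f (there x∈D) here _ =
  subst (_≤ f fzero + sumOver D (f ∘ fsuc)) (+-comm (f fzero) _)
        (+-monoʳ-≤ (f fzero) (∈⇒≤sumOver D (f ∘ fsuc) x∈D))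
∈₂⇒≤sumOver (false ∷ D) f (there x∈D) (there y∈D) x≢y =
  ∈₂⇒≤sumOver D (f ∘ fsuc) x∈D y∈D (x≢y ∘ cong fsuc)
∈₂⇒≤sumOver (true ∷ D) f (there x∈D) (there y∈D) x≢y =
  ≤-trans (∈₂⇒≤sumOver D (f ∘ fsuc) x∈D y∈D (x≢y ∘ cong fsuc)) (m≤n+m _ _)

sumOver>0⇒∃ : ∀ {n} (D : Subset n) (f : Fin n → ℕ) → 0 < sumOver D f → ∃ λ x → x ∈ D × 0 < f x
sumOver>0⇒∃ (false ∷ D) f ∑>0 with sumOver>0⇒∃ D (f ∘ fsuc) ∑>0
... | x , x∈D , fx>0 = fsuc x , there x∈D , fx>0
sumOver>0⇒∃ (true ∷ D) f ∑>0 with f fzero in f₀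
... | suc _ = fzero , here , subst (0 <_) (sym f₀) (s≤s z≤n)
... | zero with sumOver>0⇒∃ D (f ∘ fsuc) ∑>0
...   | x , x∈D , fx>0 = fsuc x , there x∈D , fx>0

-- Colourings and their transversals

module _ {A : Set} {P : Pred A 0ℓ} (P? : Decidable P) where

  length-filter-map : {B : Set} (f : B → A) (xs : List B) →
    length (filter P? (map f xs)) ≡ length (filter (P? ∘ f) xs)
  length-filter-map f []       = refl
  length-filter-map f (x ∷ xs) with does (P? (f x))
  ... | true  = cong suc (length-filter-map f xs)
  ... | false = length-filter-map f xs

  length-filter>0⇒∃ : (xs : List A) → 0 < length (filter P? xs) → ∃ P
  length-filter>0⇒∃ (x ∷ xs) len>0 with P? x
  ... | yes Px = x , Px
  ... | no  _  = length-filter>0⇒∃ xs len>0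

Colouring : ℕ → ℕ → Set
Colouring n k = Fin n → Maybe (Fin k)

module _ {n k : ℕ} {C : Fin k → Fin n → Set} (C? : ∀ i x → Dec (C i x)) where

  colouringOf : Colouring n k
  colouringOf x with any? (λ i → C? i x)
  ... | yes (i , _) = just i
  ... | no  _       = nothing

  colouringOf-sound : ∀ {i x} → colouringOf x ≡ just i → C i x
  colouringOf-sound {x = x} cx≡i with any? (λ i → C? i x)
  ... | yes (j , Cjx) = subst (λ l → C l x) (just-injective cx≡i) Cjx

  colouringOf-complete : (∀ {i j x} → C i x → C j x → i ≡ j) → ∀ {i x} → C i x → colouringOf x ≡ just i
  colouringOf-complete disjoint {i} {x} Cix with any? (λ i → C? i x)
  ... | yes (j , Cjx) = cong just (disjoint Cjx Cix)
  ... | no  ¬∃        = contradiction (i , Cix) ¬∃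

module _ {k : ℕ} where

  hits : Maybe (Fin k) → Fin k → ℕ
  hits colour i = indicator (≡-decMaybe _≟F_ colour (just i))

  misses : Maybe (Fin k) → ℕ
  misses colour = indicator (≡-decMaybe _≟F_ colour nothing)

  hits-≡ : ∀ {colour i} → colour ≡ just i → hits colour i ≡ 1
  hits-≡ {colour} {i} = indicator-yes (≡-decMaybe _≟F_ colour (just i))

  hits-≢ : ∀ {colour i j} → colour ≡ just j → j ≢ i → hits colour i ≡ 0
  hits-≢ {colour} {i} refl j≢i = indicator-no (≡-decMaybe _≟F_ colour (just i)) (j≢i ∘ just-injective)

  hits>0⇒ : (colour : Maybe (Fin k)) (i : Fin k) → 0 < hits colour i → colour ≡ just i
  hits>0⇒ colour i = indicator>0⇒ (≡-decMaybe _≟F_ colour (just i))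

  misses≡0⇒ : (colour : Maybe (Fin k)) → misses colour ≡ 0 → ∃ λ i → colour ≡ just i
  misses≡0⇒ (just i) _ = i , refl

misses+∑hits : ∀ {k} (colour : Maybe (Fin k)) → misses colour + ∑[ i < k ] hits colour i ≡ 1
misses+∑hits {k}     nothing  = cong suc (sum-replicate-zero k)
misses+∑hits {suc k} (just j) = trans (sum-remove {i = j} (hits (just j)))
  (cong₂ _+_ (hits-≡ refl)
    (trans (sum-cong-≗ {k} (λ i → hits-≢ refl (punchInᵢ≢i j i ∘ sym))) (sum-replicate-zero k)))

module _ {n k : ℕ} (c : Colouring n k) where

  colourCount : Fin k → Subset n → ℕ
  colourCount i D = sumOver D (λ x → hits (c x) i)

  uncoloured : Subset n → ℕ
  uncoloured D = sumOver D (misses ∘ c)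

  classSize : Fin k → ℕ
  classSize i = ∑[ x < n ] hits (c x) i

  ∣∣≡uncoloured+∑colourCount : (D : Subset n) → ∣ D ∣ ≡ uncoloured D + ∑[ i < k ] colourCount i D
  ∣∣≡uncoloured+∑colourCount D = begin
    ∣ D ∣                                                      ≡⟨ sumOver-const-1 D ⟨
    sumOver D (λ _ → 1)                                        ≡⟨ sumOver-cong D (λ x → misses+∑hits (c x)) ⟨
    sumOver D (λ x → misses (c x) + ∑[ i < k ] hits (c x) i)   ≡⟨ sumOver-+ D (misses ∘ c) _ ⟩
    uncoloured D + sumOver D (λ x → ∑[ i < k ] hits (c x) i)   ≡⟨ cong (uncoloured D +_) (sumOver-∑ D (hits ∘ c)) ⟩
    uncoloured D + ∑[ i < k ] colourCount i D                  ∎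
    where open ≡-Reasoning

  colourCount>0 : ∀ {D x i} → x ∈ D → c x ≡ just i → 0 < colourCount i D
  colourCount>0 {D} {x} {i} x∈D cx≡i =
    ≤-trans (≤-reflexive (sym (hits-≡ cx≡i))) (∈⇒≤sumOver D _ x∈D)

  colourCount≥2 : ∀ {D x y i} → x ∈ D → y ∈ D → x ≢ y → c x ≡ just i → c y ≡ just i →
    2 ≤ colourCount i D
  colourCount≥2 {D} {x} {y} {i} x∈D y∈D x≢y cx≡i cy≡i =
    ≤-trans (≤-reflexive (sym (cong₂ _+_ (hits-≡ cx≡i) (hits-≡ cy≡i)))) (∈₂⇒≤sumOver D _ x∈D y∈D x≢y)

  colourCount>0⇒∃ : ∀ D i → 0 < colourCount i D → ∃ λ x → x ∈ D × c x ≡ just i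
  colourCount>0⇒∃ D i count>0 with sumOver>0⇒∃ D _ count>0
  ... | x , x∈D , hit = x , x∈D , hits>0⇒ (c x) i hit

  uncoloured≡0⇒ : ∀ {D x} → uncoloured D ≡ 0 → x ∈ D → ∃ λ i → c x ≡ just i
  uncoloured≡0⇒ {D} {x} u≡0 x∈D = misses≡0⇒ (c x) (sumOver≡0⇒ D (misses ∘ c) u≡0 x∈D)

  uncoloured≡0 : ∀ D → (∀ x → x ∈ D → ∃ λ i → c x ≡ just i) → uncoloured D ≡ 0
  uncoloured≡0 D coloured = sumOver≡0 D (λ x x∈D → cong misses (proj₂ (coloured x x∈D)))

colourCount-mono : ∀ {n k} (c c′ : Colouring n k) D i → (∀ x → c x ≡ just i → c′ x ≡ just i) →
  colourCount c i D ≤ colourCount c′ i D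
colourCount-mono c c′ D i c⇒c′ =
  sumOver-mono D (λ x _ →
    indicator-mono (≡-decMaybe _≟F_ (c x) (just i)) (≡-decMaybe _≟F_ (c′ x) (just i)) (c⇒c′ x))

bit : Bool → ℕ
bit true  = 1
bit false = 0

IsTransversal : ∀ {n k} → Colouring n k → (Fin k → Bool) → Subset n → Set
IsTransversal c m D = uncoloured c D ≡ 0 × (∀ i → colourCount c i D ≡ bit (m i))

isTransversal? : ∀ {n k} (c : Colouring n k) (m : Fin k → Bool) → Decidable (IsTransversal c m)
isTransversal? c m D = (uncoloured c D ≟ 0) ×-dec all? (λ i → colourCount c i D ≟ bit (m i))

weight : ∀ {n k} → Colouring n k → (Fin k → Bool) → ℕ
weight {k = k} c m = prodFin k (λ i → if m i then classSize c i else 1)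

transversal-unique : ∀ {n k} (c : Colouring n k) {m D x y i} → IsTransversal c m D →
  x ∈ D → y ∈ D → c x ≡ just i → c y ≡ just i → x ≡ y
transversal-unique c {m} {i = i} (_ , counts) x∈D y∈D cx≡i cy≡i with _ ≟F _
... | yes x≡y = x≡y
... | no  x≢y =
  contradiction (≤-trans (colourCount≥2 c x∈D y∈D x≢y cx≡i cy≡i) (≤-reflexive (counts i))) (bit≱2 (m i))
  where
  bit≱2 : ∀ b → ¬ (2 ≤ bit b)
  bit≱2 true  (s≤s ())
  bit≱2 false ()

module _ {n k : ℕ} (c : Colouring (suc n) k) (m : Fin k → Bool) where

  weight-tail : (∀ i → m i ≡ true → hits (c fzero) i ≡ 0) → weight c m ≡ weight (tail c) m
  weight-tail c₀∉m = prodFin-cong k factor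
    where
    factor : ∀ i → (if m i then classSize c i else 1) ≡ (if m i then classSize (tail c) i else 1)
    factor i with m i in mi
    ... | true  = cong (_+ classSize (tail c) i) (c₀∉m i mi)
    ... | false = refl

  ¬transversal-uncolouredHead : ∀ D → c fzero ≡ nothing → ¬ IsTransversal c m (true ∷ D)
  ¬transversal-uncolouredHead D c₀≡nothing (u≡0 , _) =
    1+n≢0 (subst (λ col → misses col + uncoloured (tail c) D ≡ 0) c₀≡nothing u≡0)

  ¬transversal-unwantedHead : ∀ D {j} → c fzero ≡ just j → m j ≡ false → ¬ IsTransversal c m (true ∷ D)
  ¬transversal-unwantedHead D {j} c₀≡j mj≡false (_ , counts) =
    1+n≢0 (subst₂ (λ h b → h + colourCount (tail c) j D ≡ b) (hits-≡ c₀≡j) (cong bit mj≡false) (counts j))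

  module WantedHead {j : Fin k} (c₀≡j : c fzero ≡ just j) (mj≡true : m j ≡ true) where

    m′ : Fin k → Bool
    m′ = updateAt m j (λ _ → false)

    bit-split : ∀ i → bit (m i) ≡ hits (c fzero) i + bit (m′ i)
    bit-split i with i ≟F j
    ... | yes refl = begin
      bit (m i)                      ≡⟨ cong bit mj≡true ⟩
      1                              ≡⟨ cong₂ _+_ (hits-≡ c₀≡j)
                                                  (cong bit (updateAt-updates i m)) ⟨
      hits (c fzero) i + bit (m′ i) ∎
      where open ≡-Reasoning
    ... | no i≢j = sym (cong₂ _+_ (hits-≢ c₀≡j (i≢j ∘ sym))
                                    (cong bit (updateAt-minimal i j m i≢j)))

    transversal-head⇒ : ∀ D → IsTransversal c m (true ∷ D) → IsTransversal (tail c) m′ D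
    transversal-head⇒ D (u≡0 , counts) =
      m+n≡0⇒n≡0 (misses (c fzero)) u≡0 ,
      λ i → +-cancelˡ-≡ (hits (c fzero) i) _ _ (trans (counts i) (bit-split i))

    transversal-head⇐ : ∀ D → IsTransversal (tail c) m′ D → IsTransversal c m (true ∷ D)
    transversal-head⇐ D (u≡0 , counts) =
      trans (cong (λ col → misses col + uncoloured (tail c) D) c₀≡j) u≡0 ,
      λ i → trans (cong (hits (c fzero) i +_) (counts i)) (sym (bit-split i))

    weight-split : weight c m ≡ weight (tail c) m + weight (tail c) m′
    weight-split = prodFin-+-at k j first
      (λ i i≢j → cong (λ b → if m i then b else 1) (cong (_+ classSize (tail c) i) (hit0 i≢j)))
      (λ i i≢j → cong (λ b → if b then classSize (tail c) i else 1) (sym (updateAt-minimal i j m i≢j)))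
      where
      hit0 : ∀ {i} → i ≢ j → hits (c fzero) i ≡ 0
      hit0 i≢j = hits-≢ c₀≡j (i≢j ∘ sym)
      first : (if m j then classSize c j else 1) ≡
              (if m j then classSize (tail c) j else 1) + (if m′ j then classSize (tail c) j else 1)
      first = begin
        (if m j then classSize c j else 1)
          ≡⟨ cong (λ b → if b then classSize c j else 1) mj≡true ⟩
        hits (c fzero) j + classSize (tail c) j
          ≡⟨ cong (_+ classSize (tail c) j) (hits-≡ c₀≡j) ⟩
        1 + classSize (tail c) j
          ≡⟨ +-comm 1 _ ⟩
        classSize (tail c) j + 1
          ≡⟨ cong₂ _+_ (cong (λ b → if b then classSize (tail c) j else 1) mj≡true)
                       (cong (λ b → if b then classSize (tail c) j else 1) (updateAt-updates j m)) ⟨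
        (if m j then classSize (tail c) j else 1) + (if m′ j then classSize (tail c) j else 1) ∎
        where open ≡-Reasoning

  #transversals-consTrue :
    (∀ m′ → length (filter (isTransversal? (tail c) m′) (allSubsets n)) ≡ weight (tail c) m′) →
    weight (tail c) m + length (filter (isTransversal? c m ∘ (true ∷_)) (allSubsets n)) ≡ weight c m
  #transversals-consTrue #tail = withHead (c fzero) refl
    where
    open ≡-Reasoning
    T? = isTransversal? c m ∘ (true ∷_)
    S = allSubsets n
    noHead : (∀ D → ¬ IsTransversal c m (true ∷ D)) → (∀ i → m i ≡ true → hits (c fzero) i ≡ 0) →
      weight (tail c) m + length (filter T? S) ≡ weight c m
    noHead ¬T c₀∉m = begin
      weight (tail c) m + length (filter T? S)
        ≡⟨ cong (λ l → weight (tail c) m + length l) (filter-none T? (universal ¬T S)) ⟩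
      weight (tail c) m + 0  ≡⟨ +-identityʳ _ ⟩
      weight (tail c) m      ≡⟨ weight-tail c₀∉m ⟨
      weight c m             ∎
    withHead : ∀ colour → c fzero ≡ colour → weight (tail c) m + length (filter T? S) ≡ weight c m
    withHead nothing c₀≡nothing =
      noHead (λ D → ¬transversal-uncolouredHead D c₀≡nothing) (λ i _ → cong (λ col → hits col i) c₀≡nothing)
    withHead (just j) c₀≡j with m j in mj
    ... | false = noHead (λ D → ¬transversal-unwantedHead D c₀≡j mj)
                         (λ i mi → hits-≢ c₀≡j (λ { refl → contradiction (trans (sym mi) mj) λ () }))
    ... | true = begin
      weight (tail c) m + length (filter T? S)
        ≡⟨ cong (λ l → weight (tail c) m + length l)
                (filter-≐ T? (isTransversal? (tail c) m′)
                          ((λ {D} → transversal-head⇒ D) , (λ {D} → transversal-head⇐ D)) S) ⟩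
      weight (tail c) m + length (filter (isTransversal? (tail c) m′) S)
        ≡⟨ cong (weight (tail c) m +_) (#tail m′) ⟩
      weight (tail c) m + weight (tail c) m′
        ≡⟨ weight-split ⟨
      weight c m ∎
      where open WantedHead c₀≡j mj

#transversals-[] : ∀ {k} (c : Colouring 0 k) (m : Fin k → Bool) →
  length (filter (isTransversal? c m) (allSubsets 0)) ≡ weight c m
#transversals-[] {k} c m with any? (λ i → m i ≟B true)
... | yes (i , mi≡true) =
  trans (cong length (filter-reject (isTransversal? c m) {[]} {[]} ¬transversal))
        (sym (prodFin-zero k i (cong (λ b → if b then 0 else 1) mi≡true)))
  where
  ¬transversal : ¬ IsTransversal c m []
  ¬transversal (_ , counts) = 0≢1+n (trans (counts i) (cong bit mi≡true))
... | no ¬∃true =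
  trans (cong length (filter-accept (isTransversal? c m) {[]} {[]} (refl , λ i → sym (cong bit (mi≡false i)))))
        (sym (prodFin-one k (λ i → cong (λ b → if b then 0 else 1) (mi≡false i))))
  where
  mi≡false : ∀ i → m i ≡ false
  mi≡false i = ¬-not (λ mi≡true → ¬∃true (i , mi≡true))

#transversals : ∀ n {k} (c : Colouring n k) (m : Fin k → Bool) →
  length (filter (isTransversal? c m) (allSubsets n)) ≡ weight c m
#transversals zero    c m = #transversals-[] c m
#transversals (suc n) c m = begin
  length (filter T? (map (false ∷_) S ++ map (true ∷_) S))
    ≡⟨ cong length (filter-++ T? (map (false ∷_) S) _) ⟩
  length (filter T? (map (false ∷_) S) ++ filter T? (map (true ∷_) S))
    ≡⟨ length-++ (filter T? (map (false ∷_) S)) ⟩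
  length (filter T? (map (false ∷_) S)) + length (filter T? (map (true ∷_) S))
    ≡⟨ cong₂ _+_ (length-filter-map T? (false ∷_) S) (length-filter-map T? (true ∷_) S) ⟩
  length (filter (isTransversal? (tail c) m) S) + length (filter (T? ∘ (true ∷_)) S)
    ≡⟨ cong (_+ length (filter (T? ∘ (true ∷_)) S)) (#transversals n (tail c) m) ⟩
  weight (tail c) m + length (filter (T? ∘ (true ∷_)) S)
    ≡⟨ #transversals-consTrue c m (#transversals n (tail c)) ⟩
  weight c m ∎
  where
  open ≡-Reasoning
  T? = isTransversal? c m
  S = allSubsets n

∃≢₂ : ∀ {k} → 3 ≤ k → (i j : Fin k) → ∃ λ l → l ≢ i × l ≢ j
∃≢₂ (s≤s (s≤s (s≤s _))) i j with fzero ≟F i | fzero ≟F j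
... | no 0≢i   | no 0≢j   = fzero , 0≢i , 0≢j
... | yes refl | yes refl = fsuc fzero , (λ ()) , (λ ())
... | yes refl | no _ with fsuc fzero ≟F j
...   | yes refl = fsuc (fsuc fzero) , (λ ()) , (λ ())
...   | no 1≢j   = fsuc fzero , (λ ()) , 1≢j
∃≢₂ (s≤s (s≤s (s≤s _))) i j | no _ | yes refl with fsuc fzero ≟F i
...   | yes refl = fsuc (fsuc fzero) , (λ ()) , (λ ())
...   | no 1≢i   = fsuc fzero , 1≢i , (λ ())

∣∧<⇒≡0 : ∀ {n x} → n ∣ x → x < n → x ≡ 0
∣∧<⇒≡0 {x = zero}  _   _   = refl
∣∧<⇒≡0 {x = suc x} n∣x x<n = contradiction (∣⇒≤ n∣x) (<⇒≱ x<n)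

prime∣prime⇒≡ : ∀ {a b} → Prime a → Prime b → a ∣ b → a ≡ b
prime∣prime⇒≡ pa pb a∣b with prime⇒irreducible pb a∣b
... | inj₂ a≡b  = a≡b
... | inj₁ refl = contradiction pa ¬prime[1]

prime∤⇒coprime : ∀ {p v} → Prime p → ¬ (p ∣ v) → Coprime p v
prime∤⇒coprime pp p∤v (d∣p , d∣v) with prime⇒irreducible pp d∣p
... | inj₁ d≡1 = d≡1
... | inj₂ refl = contradiction d∣v p∤v

coprime-* : ∀ {a b v} → Coprime a v → Coprime b v → Coprime (a * b) v
coprime-* {a} {b} {v} a⊥v b⊥v {d} (d∣ab , d∣v) = b⊥v (coprime-divisor d⊥a d∣ab , d∣v)
  where
  d⊥a : Coprime d a
  d⊥a (e∣d , e∣a) = a⊥v (e∣a , ∣-trans e∣d d∣v)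

coprime-^ : ∀ {a v} m → Coprime a v → Coprime (a ^ m) v
coprime-^ zero    _   = 1-coprimeTo _
coprime-^ (suc m) a⊥v = coprime-* a⊥v (coprime-^ m a⊥v)

coprime-prodFin : ∀ k (f : Fin k → ℕ) {v} → (∀ i → Coprime (f i) v) → Coprime (prodFin k f) v
coprime-prodFin zero    f _   = 1-coprimeTo _
coprime-prodFin (suc k) f f⊥v = coprime-* (f⊥v fzero) (coprime-prodFin k (f ∘ fsuc) (f⊥v ∘ fsuc))

complement-∣ : ∀ {N v w} u → w + v ≡ N → N ∣ u * v → N ∣ u * w
complement-∣ {N} {v} {w} u w+v≡N N∣uv = ∣m+n∣m⇒∣n (subst (N ∣_) uN≡uv+uw (n∣m*n u)) N∣uv
  where
  uN≡uv+uw : u * N ≡ u * v + u * w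
  uN≡uv+uw = trans (cong (u *_) (trans (sym w+v≡N) (+-comm w v))) (*-distribˡ-+ u v w)

-- The zero-divisor graph of ℤ_n

module ZeroDivisorGraph (n k : ℕ) (k≥3 : 3 ≤ k) (p α : Fin k → ℕ)
  (p-prime : ∀ i → Prime (p i)) (p-injective : ∀ i j → p i ≡ p j → i ≡ j) (α>0 : ∀ i → 1 ≤ α i)
  (n≡∏ : n ≡ prodFin k (λ i → p i ^ α i)) where

  instance
    p-nonZero : ∀ {i} → NonZero (p i)
    p-nonZero {i} = prime⇒nonZero (p-prime i)

  p≥2 : ∀ i → 2 ≤ p i
  p≥2 i = nonTrivial⇒n>1 (p i) {{prime⇒nonTrivial (p-prime i)}}

  p∣p⇒≡ : ∀ {i j} → p i ∣ p j → i ≡ j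
  p∣p⇒≡ {i} {j} pi∣pj = p-injective i j (prime∣prime⇒≡ (p-prime i) (p-prime j) pi∣pj)

  0<n : 0 < n
  0<n = subst (0 <_) (sym n≡∏) (prodFin>0 k _ (λ i → m^n>0 (p i) (α i)))

  p∣n : ∀ i → p i ∣ n
  p∣n i = subst (p i ∣_) (sym n≡∏) (∣-trans (p∣p^α (α>0 i)) (∣prodFin k (λ i → p i ^ α i) i))
    where
    p∣p^α : ∀ {a} → 1 ≤ a → p i ∣ p i ^ a
    p∣p^α {suc a} _ = m∣m*n (p i ^ a)

  q : Fin k → ℕ
  q i = quotient (p∣n i)

  n≡q*p : ∀ i → n ≡ q i * p i
  n≡q*p i = m∣n⇒n≡quotient*m (p∣n i)

  n≡p*q : ∀ i → n ≡ p i * q i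
  n≡p*q i = trans (n≡q*p i) (*-comm (q i) (p i))

  q∣n : ∀ i → q i ∣ n
  q∣n i = subst (q i ∣_) (sym (n≡q*p i)) (m∣m*n (p i))

  p∣q : ∀ {l j} → l ≢ j → p l ∣ q j
  p∣q {l} {j} l≢j with euclidsLemma (q j) (p j) (p-prime l) (subst (p l ∣_) (n≡q*p j) (p∣n l))
  ... | inj₁ pl∣qj = pl∣qj
  ... | inj₂ pl∣pj = contradiction (p∣p⇒≡ pl∣pj) l≢j

  -- n / p j has a prime factor p l with l ∉ {i, j}; this is where k ≥ 3 is needed.
  q∤p : ∀ i j → ¬ (q j ∣ p i)
  q∤p i j qj∣pi with ∃≢₂ k≥3 i j
  ... | l , l≢i , l≢j = l≢i (p∣p⇒≡ (∣-trans (p∣q l≢j) qj∣pi))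

  q≢0 : ∀ i → q i ≢ 0
  q≢0 i qi≡0 = <⇒≢ 0<n (sym (trans (n≡q*p i) (cong (_* p i) qi≡0)))

  instance
    q-nonZero : ∀ {i} → NonZero (q i)
    q-nonZero {i} = ≢-nonZero (q≢0 i)

  q≥2 : ∀ i → 2 ≤ q i
  q≥2 i with ∃≢₂ k≥3 i i
  ... | l , l≢i , _ = ≤-trans (p≥2 l) (∣⇒≤ (p∣q l≢i))

  p<n : ∀ i → p i < n
  p<n i = subst (p i <_) (sym (n≡p*q i)) (m<m*n (p i) (q i) (q≥2 i))

  q<n : ∀ i → q i < n
  q<n i = subst (q i <_) (sym (n≡q*p i)) (m<m*n (q i) (p i) (p≥2 i))

  p+p≢n : ∀ i → p i + p i ≢ n
  p+p≢n i p+p≡n with ∃≢₂ k≥3 i i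
  ... | l , l≢i , _ = q∤p l i (subst (_∣ p l) (sym qi≡pl) ∣-refl)
    where
    qi≡2 : q i ≡ 2
    qi≡2 = *-cancelʳ-≡ (q i) 2 (p i)
      (trans (sym (n≡q*p i)) (trans (sym p+p≡n) (cong (p i +_) (sym (+-identityʳ (p i))))))
    qi≡pl : q i ≡ p l
    qi≡pl = trans qi≡2 (sym (prime∣prime⇒≡ (p-prime l) prime[2] (subst (p l ∣_) qi≡2 (p∣q l≢i))))

  q-multiples-disjoint : ∀ {i j x} → i ≢ j → q i ∣ x → q j ∣ x → x < n → x ≡ 0
  q-multiples-disjoint {i} {j} {x} i≢j (divides a x≡a*qi) qj∣x x<n = ∣∧<⇒≡0 n∣x x<n
    where
    pi*qi∣pj*a*qi : p i * q i ∣ p j * a * q i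
    pi*qi∣pj*a*qi = subst₂ _∣_ (n≡p*q i) (trans (cong (p j *_) x≡a*qi) (sym (*-assoc (p j) a (q i))))
      (subst (_∣ p j * x) (sym (n≡p*q j)) (*-monoʳ-∣ (p j) qj∣x))
    pi∣a : p i ∣ a
    pi∣a with euclidsLemma (p j) a (p-prime i) (*-cancelʳ-∣ (q i) pi*qi∣pj*a*qi)
    ... | inj₁ pi∣pj = contradiction (p∣p⇒≡ pi∣pj) i≢j
    ... | inj₂ pi∣a  = pi∣a
    n∣x : n ∣ x
    n∣x = subst₂ _∣_ (sym (n≡p*q i)) (sym x≡a*qi) (*-monoˡ-∣ (q i) pi∣a)

  annihilated⇒∃p∣ : ∀ {v y} → y ≢ 0 → y < n → n ∣ v * y → ∃ λ i → p i ∣ v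
  annihilated⇒∃p∣ {v} {y} y≢0 y<n n∣vy with any? (λ i → p i ∣? v)
  ... | yes p∣v = p∣v
  ... | no  ¬∃  = contradiction (∣∧<⇒≡0 (coprime-divisor n⊥v n∣vy) y<n) y≢0
    where
    n⊥v : Coprime n v
    n⊥v = subst (λ m → Coprime m v) (sym n≡∏) (coprime-prodFin k (λ i → p i ^ α i)
      (λ i → coprime-^ (α i) (prime∤⇒coprime (p-prime i) (λ pi∣v → ¬∃ (i , pi∣v)))))

  -- Residues mod n are elements of Fin n. C i is the neighbourhood of the vertex p i in Γ(ℤ_n),
  -- and Special i consists of ±p i, the two vertices with that neighbourhood.
  C : Fin k → Fin n → Set
  C i x = toℕ x ≢ 0 × q i ∣ toℕ x

  Special : Fin k → Fin n → Set
  Special i x = toℕ x ≡ p i ⊎ toℕ x + p i ≡ n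

  T : Fin k → Fin n → Set
  T i x = C i x ⊎ Special i x

  C? : ∀ i x → Dec (C i x)
  C? i x = ¬? (toℕ x ≟ 0) ×-dec (q i ∣? toℕ x)

  T? : ∀ i x → Dec (T i x)
  T? i x = C? i x ⊎-dec ((toℕ x ≟ p i) ⊎-dec (toℕ x + p i ≟ n))

  C-disjoint : ∀ {i j x} → C i x → C j x → i ≡ j
  C-disjoint {i} {j} {x} (x≢0 , qi∣x) (_ , qj∣x) with i ≟F j
  ... | yes i≡j = i≡j
  ... | no  i≢j = contradiction (q-multiples-disjoint i≢j qi∣x qj∣x (toℕ<n x)) x≢0

  C∩Special≡∅ : ∀ {i j x} → C i x → ¬ Special j x
  C∩Special≡∅ {i} {j} (_ , qi∣x) (inj₁ x≡pj)   = q∤p j i (subst (q i ∣_) x≡pj qi∣x)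
  C∩Special≡∅ {i} {j} (_ , qi∣x) (inj₂ x+pj≡n) =
    q∤p j i (∣m+n∣m⇒∣n (subst (q i ∣_) (sym x+pj≡n) (q∣n i)) qi∣x)

  Special-disjoint : ∀ {i j x} → Special i x → Special j x → i ≡ j
  Special-disjoint {i} {j} (inj₁ x≡pi)   (inj₁ x≡pj)   = p-injective i j (trans (sym x≡pi) x≡pj)
  Special-disjoint {i} {j} (inj₁ x≡pi)   (inj₂ x+pj≡n) = p+p′≡n⇒≡ (trans (cong (_+ p j) (sym x≡pi)) x+pj≡n)
    where
    p+p′≡n⇒≡ : p i + p j ≡ n → i ≡ j
    p+p′≡n⇒≡ pi+pj≡n = p∣p⇒≡ (∣m+n∣m⇒∣n (subst (p i ∣_) (sym pi+pj≡n) (p∣n i)) ∣-refl)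
  Special-disjoint (inj₂ x+pi≡n) (inj₁ x≡pj)   = sym (Special-disjoint (inj₁ x≡pj) (inj₂ x+pi≡n))
  Special-disjoint {i} {j} {x} (inj₂ x+pi≡n) (inj₂ x+pj≡n) =
    p-injective i j (+-cancelˡ-≡ (toℕ x) (p i) (p j) (trans x+pi≡n (sym x+pj≡n)))

  T-disjoint : ∀ {i j x} → T i x → T j x → i ≡ j
  T-disjoint (inj₁ Cix) (inj₁ Cjx) = C-disjoint Cix Cjx
  T-disjoint (inj₁ Cix) (inj₂ Sjx) = contradiction Sjx (C∩Special≡∅ Cix)
  T-disjoint (inj₂ Six) (inj₁ Cjx) = contradiction Six (C∩Special≡∅ Cjx)
  T-disjoint (inj₂ Six) (inj₂ Sjx) = Special-disjoint Six Sjx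

  c c′ : Colouring n k
  c  = colouringOf C?
  c′ = colouringOf T?

  c-complete : ∀ {i x} → C i x → c x ≡ just i
  c-complete = colouringOf-complete C? C-disjoint

  c′-complete : ∀ {i x} → T i x → c′ x ≡ just i
  c′-complete = colouringOf-complete T? T-disjoint

  pᶠ −pᶠ qᶠ : Fin k → Fin n
  pᶠ  i = fromℕ< (p<n i)
  −pᶠ i = fromℕ< (∸-monoʳ-< {n} {p i} {0} (≤-trans (s≤s z≤n) (p≥2 i)) (<⇒≤ (p<n i)))
  qᶠ  i = fromℕ< (q<n i)

  toℕ-pᶠ : ∀ i → toℕ (pᶠ i) ≡ p i
  toℕ-pᶠ i = toℕ-fromℕ< (p<n i)

  toℕ-−pᶠ : ∀ i → toℕ (−pᶠ i) + p i ≡ n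
  toℕ-−pᶠ i = trans (cong (_+ p i) (toℕ-fromℕ< _)) (m∸n+n≡m (<⇒≤ (p<n i)))

  toℕ-qᶠ : ∀ i → toℕ (qᶠ i) ≡ q i
  toℕ-qᶠ i = toℕ-fromℕ< (q<n i)

  Special-twin : ∀ {i x} → Special i x → ∃ λ w → Special i w × w ≢ x
  Special-twin {i} (inj₁ x≡pi) =
    −pᶠ i , inj₂ (toℕ-−pᶠ i) , λ { refl → p+p≢n i (subst (λ z → z + p i ≡ n) x≡pi (toℕ-−pᶠ i)) }
  Special-twin {i} (inj₂ x+pi≡n) =
    pᶠ i , inj₁ (toℕ-pᶠ i) , λ { refl → p+p≢n i (subst (λ z → z + p i ≡ n) (toℕ-pᶠ i) x+pi≡n) }

  n∣q*p : ∀ i → n ∣ q i * p i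
  n∣q*p i = subst (_∣ q i * p i) (sym (n≡q*p i)) ∣-refl

  Special-n∣q* : ∀ {i w} → Special i w → n ∣ q i * toℕ w
  Special-n∣q* {i} (inj₁ w≡pi)   = subst (λ z → n ∣ q i * z) (sym w≡pi) (n∣q*p i)
  Special-n∣q* {i} (inj₂ w+pi≡n) = complement-∣ (q i) w+pi≡n (n∣q*p i)

  Special-isVertex : ∀ {i w} → Special i w → IsVertex n w
  Special-isVertex {i} {w} Siw =
    w≢0 Siw , qᶠ i , (λ qᶠ≡0 → q≢0 i (trans (sym (toℕ-qᶠ i)) qᶠ≡0)) ,
    subst (n ∣_) (trans (*-comm (q i) (toℕ w)) (cong (toℕ w *_) (sym (toℕ-qᶠ i)))) (Special-n∣q* Siw)
    where
    w≢0 : Special i w → toℕ w ≢ 0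
    w≢0 (inj₁ w≡pi)   w≡0 = ≢-nonZero⁻¹ (p i) (trans (sym w≡pi) w≡0)
    w≢0 (inj₂ w+pi≡n) w≡0 = <⇒≢ (p<n i) (trans (sym (cong (_+ p i) w≡0)) w+pi≡n)

  Special-neighbour : ∀ {i w u} → Special i w → toℕ u ≢ 0 → n ∣ toℕ u * toℕ w → C i u
  Special-neighbour {i} {w} {u} Siw u≢0 n∣uw =
    u≢0 , *-cancelʳ-∣ (p i) (subst (_∣ toℕ u * p i) (n≡q*p i) (n∣up Siw))
    where
    n∣up : Special i w → n ∣ toℕ u * p i
    n∣up (inj₁ w≡pi)   = subst (λ z → n ∣ toℕ u * z) w≡pi n∣uw
    n∣up (inj₂ w+pi≡n) = complement-∣ (toℕ u) (trans (+-comm (p i) (toℕ w)) w+pi≡n) n∣uw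

  C-annihilates : ∀ {i x v} → C i x → p i ∣ v → n ∣ toℕ x * v
  C-annihilates {i} {x} {v} (_ , qi∣x) pi∣v = subst (_∣ toℕ x * v) (sym (n≡q*p i)) (*-pres-∣ qi∣x pi∣v)

  C-isVertex : ∀ {i x} → C i x → IsVertex n x
  C-isVertex {i} Cix = proj₁ Cix , pᶠ i , (λ pᶠ≡0 → ≢-nonZero⁻¹ (p i) (trans (sym (toℕ-pᶠ i)) pᶠ≡0)) ,
    C-annihilates Cix (subst (p i ∣_) (sym (toℕ-pᶠ i)) ∣-refl)

  dominating-meets-T : ∀ {E} → IsDominating n E → ∀ i → 0 < colourCount c′ i E
  dominating-meets-T {E} (E-vertices , E-dominates) i with pᶠ i ∈? E
  ... | yes p∈E = colourCount>0 c′ p∈E (c′-complete (inj₂ (inj₁ (toℕ-pᶠ i))))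
  ... | no  p∉E with E-dominates (pᶠ i) (Special-isVertex (inj₁ (toℕ-pᶠ i))) p∉E
  ...   | u , u∈E , _ , n∣up =
    colourCount>0 c′ u∈E
      (c′-complete (inj₁ (Special-neighbour (inj₁ (toℕ-pᶠ i)) (proj₁ (E-vertices u u∈E)) n∣up)))

  dominating⇒k≤∣∣ : ∀ {E} → IsDominating n E → k ≤ ∣ E ∣
  dominating⇒k≤∣∣ {E} E-dominating = begin
    k                                            ≤⟨ ∑≥k k _ (dominating-meets-T E-dominating) ⟩
    ∑[ i < k ] colourCount c′ i E                ≤⟨ m≤n+m _ (uncoloured c′ E) ⟩
    uncoloured c′ E + ∑[ i < k ] colourCount c′ i E ≡⟨ ∣∣≡uncoloured+∑colourCount c′ E ⟨
    ∣ E ∣                                        ∎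
    where open ≤-Reasoning

  allColours : Fin k → Bool
  allColours _ = true

  small-dominating⇒T-transversal : ∀ {D} → IsDominating n D → ∣ D ∣ ≤ k → IsTransversal c′ allColours D
  small-dominating⇒T-transversal {D} D-dominating ∣D∣≤k =
    n≤0⇒n≡0 (+-cancelʳ-≤ (∑[ i < k ] colourCount c′ i D) _ 0 (≤-trans size≤k (∑≥k k _ counts>0))) ,
    ∑≤k⇒≡1 k _ counts>0 (≤-trans (m≤n+m _ (uncoloured c′ D)) size≤k)
    where
    counts>0 = dominating-meets-T D-dominating
    size≤k : uncoloured c′ D + ∑[ i < k ] colourCount c′ i D ≤ k
    size≤k = subst (_≤ k) (∣∣≡uncoloured+∑colourCount c′ D) ∣D∣≤k

  module _ (D : Subset n) (D-dominating : IsDominating n D) (D-T : IsTransversal c′ allColours D) where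

    T-unique : ∀ {i x y} → x ∈ D → y ∈ D → T i x → T i y → x ≡ y
    T-unique x∈D y∈D Tix Tiy = transversal-unique c′ D-T x∈D y∈D (c′-complete Tix) (c′-complete Tiy)

    -- Both ±p i have neighbourhood C i ⊆ T i, so whichever of them is not in D is dominated by
    -- a second element of colour i.
    T-transversal∌Special : ∀ {i x} → x ∈ D → ¬ Special i x
    T-transversal∌Special {i} {x} x∈D Six with Special-twin Six
    ... | w , Siw , w≢x with w ∈? D
    ...   | yes w∈D = w≢x (T-unique w∈D x∈D (inj₂ Siw) (inj₂ Six))
    ...   | no  w∉D with proj₂ D-dominating w (Special-isVertex Siw) w∉D
    ...     | u , u∈D , _ , n∣uw =
      C∩Special≡∅ Ciu (subst (Special i) (T-unique x∈D u∈D (inj₂ Six) (inj₁ Ciu)) Six)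
      where
      Ciu : C i u
      Ciu = Special-neighbour Siw (proj₁ (proj₁ D-dominating u u∈D)) n∣uw

    T-transversal⊆C : ∀ {x} → x ∈ D → ∃ λ i → C i x
    T-transversal⊆C x∈D with uncoloured≡0⇒ c′ (proj₁ D-T) x∈D
    ... | i , c′x≡i with colouringOf-sound T? c′x≡i
    ...   | inj₁ Cix = i , Cix
    ...   | inj₂ Six = contradiction Six (T-transversal∌Special x∈D)

    T-transversal⇒C-transversal : IsTransversal c allColours D
    T-transversal⇒C-transversal =
      uncoloured≡0 c D (λ x x∈D → proj₁ (T-transversal⊆C x∈D) , c-complete (proj₂ (T-transversal⊆C x∈D))) ,
      λ i → ≤-antisym (≤-trans (colourCount-mono c c′ D i (λ x → c′-complete ∘ inj₁ ∘ colouringOf-sound C?))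
                               (≤-reflexive (proj₂ D-T i)))
                      (colour-i-in-C i)
      where
      colour-i-in-C : ∀ i → 0 < colourCount c i D
      colour-i-in-C i with colourCount>0⇒∃ c′ D i (≤-reflexive (sym (proj₂ D-T i)))
      ... | x , x∈D , c′x≡i with T-transversal⊆C x∈D
      ...   | j , Cjx =
        colourCount>0 c x∈D (c-complete (subst (λ l → C l x) (T-disjoint (inj₁ Cjx) (colouringOf-sound T? c′x≡i)) Cjx))

  module _ (D : Subset n) (D-C : IsTransversal c allColours D) where

    C-transversal⇒dominating : IsDominating n D
    C-transversal⇒dominating = D-vertices , D-dominates
      where
      D-vertices : ∀ x → x ∈ D → IsVertex n x
      D-vertices x x∈D = C-isVertex (colouringOf-sound C? (proj₂ (uncoloured≡0⇒ c (proj₁ D-C) x∈D)))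
      D-dominates : ∀ v → IsVertex n v → v ∉ D → ∃ λ u → u ∈ D × Adj n u v
      D-dominates v (_ , y , y≢0 , n∣vy) v∉D with annihilated⇒∃p∣ y≢0 (toℕ<n y) n∣vy
      ... | i , pi∣v with colourCount>0⇒∃ c D i (≤-reflexive (sym (proj₂ D-C i)))
      ...   | u , u∈D , cu≡i =
        u , u∈D , (λ { refl → v∉D u∈D }) , C-annihilates (colouringOf-sound C? cu≡i) pi∣v

    C-transversal⇒∣∣≡k : ∣ D ∣ ≡ k
    C-transversal⇒∣∣≡k = begin
      ∣ D ∣                                          ≡⟨ ∣∣≡uncoloured+∑colourCount c D ⟩
      uncoloured c D + ∑[ i < k ] colourCount c i D  ≡⟨ cong₂ _+_ (proj₁ D-C) (sum-cong-≗ {k} (proj₂ D-C)) ⟩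
      ∑[ i < k ] 1                                   ≡⟨ ∑-const-1 k ⟩
      k                                              ∎
      where open ≡-Reasoning

  classSize≡p∸1 : ∀ i → classSize c i ≡ p i ∸ 1
  classSize≡p∸1 i = begin
    ∑[ x < n ] hits (c x) i
      ≡⟨ sum-cong-≗ {n} (λ x → indicator-cong _ (C? i x) (colouringOf-sound C?) c-complete) ⟩
    ∑[ x < n ] indicator (C? i x)
      ≡⟨ cong (λ m → ∑[ x < m ] indicator (¬? (toℕ x ≟ 0) ×-dec (q i ∣? toℕ x))) (n≡p*q i) ⟩
    ∑[ x < p i * q i ] indicator (¬? (toℕ x ≟ 0) ×-dec (q i ∣? toℕ x))
      ≡⟨ ∑-nonzeroMultiples (p i) (q i) ⟩
    p i ∸ 1 ∎
    where open ≡-Reasoning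

  #C-transversals : length (filter (isTransversal? c allColours) (allSubsets n)) ≡ prodFin k (λ i → p i ∸ 1)
  #C-transversals = trans (#transversals n c allColours) (prodFin-cong k classSize≡p∸1)

  ∃C-transversal : ∃ (IsTransversal c allColours)
  ∃C-transversal = length-filter>0⇒∃ (isTransversal? c allColours) (allSubsets n)
    (subst (0 <_) (sym #C-transversals) (prodFin>0 k _ (λ i → ∸-monoˡ-≤ 1 (p≥2 i))))

  minDominating⇔C-transversal : IsMinDominating n ≐ IsTransversal c allColours
  minDominating⇔C-transversal = minDominating⇒C-transversal , C-transversal⇒minDominating
    where
    minDominating⇒C-transversal : IsMinDominating n ⊆ IsTransversal c allColours
    minDominating⇒C-transversal {D} (D-dominating , D-minimal) with ∃C-transversal
    ... | E , E-C = T-transversal⇒C-transversal D D-dominating (small-dominating⇒T-transversal D-dominating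
          (≤-trans (D-minimal E (C-transversal⇒dominating E E-C)) (≤-reflexive (C-transversal⇒∣∣≡k E E-C))))
    C-transversal⇒minDominating : IsTransversal c allColours ⊆ IsMinDominating n
    C-transversal⇒minDominating {D} D-C = C-transversal⇒dominating D D-C ,
      λ E E-dominating → subst (_≤ ∣ E ∣) (sym (C-transversal⇒∣∣≡k D D-C)) (dominating⇒k≤∣∣ E-dominating)

theorem3p20 : (n k : ℕ) → 3 ≤ k → (p α : Fin k → ℕ) →
    (∀ i → Prime (p i)) → (∀ i j → p i ≡ p j → i ≡ j) → (∀ i → 1 ≤ α i) →
    n ≡ prodFin k (λ i → p i ^ α i) →
    minDomCount n ≡ prodFin k (λ i → p i ∸ 1)
theorem3p20 n k k≥3 p α p-prime p-injective α>0 n≡∏ = begin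
  length (filter (IsMinDominating? n) (allSubsets n))
    ≡⟨ cong length (filter-≐ (IsMinDominating? n) (isTransversal? c allColours)
                             minDominating⇔C-transversal (allSubsets n)) ⟩
  length (filter (isTransversal? c allColours) (allSubsets n))
    ≡⟨ #C-transversals ⟩
  prodFin k (λ i → p i ∸ 1) ∎
  where
  open ≡-Reasoning
  open ZeroDivisorGraph n k k≥3 p α p-prime p-injective α>0 n≡∏
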